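{- For every integer $m\ge0$ and every $w\in\mathfrak{h}$, \[ \bar\sigma_m(w)=\sum_{j=0}^{m}f_j(\sigma_{m-j}(w)). \]
   Context: Let $\mathfrak{h}=\mathbb{Q}\langle x,y\rangle$, $z=x+y$, $T$ a formal variable. Let $\sigma:\mathfrak{h}\to\mathfrak{h}[[T]]$ be the ring homomorphism with $\sigma(x)=x$, $\sigma(y)=y\sum_{n\ge0}x^nT^n$, and define linear maps $\sigma_m:\mathfrak{h}\to\mathfrak{h}$ by $\sigma(w)=\sum_{m\ge0}T^m\sigma_m(w)$, with $\sigma_n=0$ for $n<0$. Let $\tau$ be the anti-automorphism of $\mathfrak{h}$ with $\tau(x)=y$, $\tau(y)=x$, and $\bar\sigma_m=\tau\circ\sigma_m\circ\tau$. The harmonic product $*$ on $\mathfrak{h}$ is the bilinear map with $1*w=w*1=w$, $xw_1*w_2=w_1*xw_2=x(w_1*w_2)$, $yw_1*yw_2=y(w_1*yw_2)+y(yw_1*w_2)+yx(w_1*w_2)$. Let $\varphi$ be the automorphism of $\mathfrak{h}$ with $\varphi(x)=z$, $\varphi(y)=-y$, and $w_1\diamond w_2=\varphi(\varphi(w_1)*\varphi(w_2))$. For $n\in\mathbb{Z}$, $f_n(w)=0$ if $n<0$, $f_0(w)=w$, $f_n(w)=y^n\diamond w-(y^{n-1}\diamond w)y$ if $n\ge1$. -}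

module Defs where

open import Data.Nat using (ℕ; zero; suc; _∸_)
open import Data.Integer using (ℤ; +_; -[1+_])
open import Data.Rational using (ℚ; 0ℚ; 1ℚ; _+_; _*_; -_)
open import Data.List using (List; []; _∷_; _++_; map; concatMap; foldr; upTo; reverse)
open import Data.Product using (_×_; _,_)
open import Relation.Binary.PropositionalEquality using (_≡_; refl)
open import Relation.Nullary using (Dec; yes; no)
import Data.List.Properties as LP

data Letter : Set where
  X Y : Letter

_≟L_ : (a b : Letter) → Dec (a ≡ b)
X ≟L X = yes refl
X ≟L Y = no (λ ())
Y ≟L X = no (λ ())
Y ≟L Y = yes refl

Word : Set
Word = List Letter

_≟W_ : (u v : Word) → Dec (u ≡ v)
_≟W_ = LP.≡-dec _≟L_

-- An element of 𝔥 is a formal finite ℚ-linear combination of words.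
Poly : Set
Poly = List (ℚ × Word)

coeff : Poly → Word → ℚ
coeff [] u = 0ℚ
coeff ((c , v) ∷ p) u with v ≟W u
... | yes _ = c + coeff p u
... | no _  = coeff p u

infix 4 _≈_
_≈_ : Poly → Poly → Set
p ≈ q = ∀ u → coeff p u ≡ coeff q u

0P : Poly
0P = []

1P : Poly
1P = (1ℚ , []) ∷ []

wordP : Word → Poly
wordP u = (1ℚ , u) ∷ []

xP yP : Poly
xP = wordP (X ∷ [])
yP = wordP (Y ∷ [])

infixl 6 _+P_ _-P_
infixl 7 _·P_ _⋆_

_+P_ : Poly → Poly → Poly
p +P q = p ++ q

_⋆_ : ℚ → Poly → Poly
c ⋆ p = map (λ { (a , u) → (c * a , u) }) p

negP : Poly → Poly
negP p = (- 1ℚ) ⋆ p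

_-P_ : Poly → Poly → Poly
p -P q = p +P negP q

_·P_ : Poly → Poly → Poly
p ·P q = concatMap (λ { (a , u) → map (λ { (b , v) → (a * b , u ++ v) }) q }) p

powP : Poly → ℕ → Poly
powP p zero    = 1P
powP p (suc n) = p ·P powP p n

sumP : List Poly → Poly
sumP = foldr _+P_ 0P

lin : (Word → Poly) → Poly → Poly
lin f p = sumP (map (λ { (c , u) → c ⋆ f u }) p)

bilin : (Word → Word → Poly) → Poly → Poly → Poly
bilin f p q = lin (λ u → lin (λ v → f u v) q) p

-- Formal power series 𝔥[[T]] (coefficient sequences) and σ

Series : Set
Series = ℕ → Poly

_·S_ : Series → Series → Series
(f ·S g) m = sumP (map (λ j → f j ·P g (m ∸ j)) (upTo (suc m)))

oneS : Series
oneS zero    = 1P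
oneS (suc _) = 0P

constS : Poly → Series
constS p zero    = p
constS p (suc _) = 0P

σLetter : Letter → Series
σLetter X = constS xP
σLetter Y = λ n → yP ·P powP xP n

σWord : Word → Series
σWord []      = oneS
σWord (a ∷ w) = σLetter a ·S σWord w

σ_ : ℕ → Poly → Poly
(σ m) p = lin (λ u → σWord u m) p

swapL : Letter → Letter
swapL X = Y
swapL Y = X

τ : Poly → Poly
τ = lin (λ u → wordP (reverse (map swapL u)))

σ̄_ : ℕ → Poly → Poly
(σ̄ m) p = τ ((σ m) (τ p))

harmW : Word → Word → Poly
harmW []      v       = wordP v
harmW (a ∷ u) []      = wordP (a ∷ u)
harmW (X ∷ u) v       = xP ·P harmW u v
harmW (Y ∷ u) (X ∷ v) = xP ·P harmW (Y ∷ u) v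
harmW (Y ∷ u) (Y ∷ v) =
  yP ·P harmW u (Y ∷ v) +P yP ·P harmW (Y ∷ u) v +P (yP ·P xP) ·P harmW u v

infixl 7 _✱_ _◇_
_✱_ : Poly → Poly → Poly
_✱_ = bilin harmW

φLetter : Letter → Poly
φLetter X = xP +P yP
φLetter Y = negP yP

φWord : Word → Poly
φWord []      = 1P
φWord (a ∷ w) = φLetter a ·P φWord w

φ : Poly → Poly
φ = lin φWord

_◇_ : Poly → Poly → Poly
w₁ ◇ w₂ = φ (φ w₁ ✱ φ w₂)

f : ℤ → Poly → Poly
f -[1+ _ ]     w = 0P
f (+ zero)     w = w
f (+ (suc n))  w = powP yP (suc n) ◇ w -P (powP yP n ◇ w) ·P yP

Σ[j≤_]_ : ℕ → (ℕ → Poly) → Poly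
Σ[j≤ m ] g = sumP (map g (upTo (suc m)))

-- Both sides are linear in w, so it suffices to compare, for a word w, the series
-- m ↦ σ̄_m(w) and m ↦ Σ_{i+k=m} f_i(σ_k(w)), by induction on w from the left.
-- Since τ reverses words, σ̄(yu) = y σ̄(u) and σ̄_{m+1}(xu) = x σ̄_{m+1}(u) + y σ̄_m(xu).
-- On the other side, f_n commutes with left multiplication by z = x + y (x can be pulled out of the
-- harmonic product, and φ exchanges x and z), and transporting through φ the recursion of the harmonic
-- product for two words beginning with y gives f_{n+1}(yb) = y f_n(yb) + y f_{n+1}(b) − yz f_n(b).
-- For w = xu one writes x = z − y; for w = yu one has σ(yu) = y A with A = (Σ xⁿTⁿ) σ(u), and the
-- recursion for f turns into Σ_{i+k=m} f_i(y A_k) = y Σ_{i+k=m} f_i(σ_k(u)).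

module Submission where

open import Defs
open import Algebra.Bundles using (AbelianGroup; Ring)
import Algebra.Properties.Ring
open import Algebra.Structures using (IsAbelianGroup)
open import Data.Empty using (⊥-elim)
open import Data.Integer using (+_)
open import Data.List using ([]; _∷_; _++_; map; upTo; reverse; length; filter)
import Data.List.Properties as List
open import Data.Nat using (ℕ; zero; suc; _∸_; _≤_; s≤s)
import Data.Nat.Properties as ℕ
open import Data.Product using (_,_; proj₂)
open import Data.Rational using (0ℚ; 1ℚ; -_)
import Data.Rational as ℚ
import Data.Rational.Properties as ℚₚ
open import Function using (_∘_)
open import Relation.Binary.Bundles using (Setoid)
open import Relation.Binary.PropositionalEquality
import Relation.Binary.Reasoning.Setoid as SetoidReasoning
open import Relation.Nullary using (Dec; yes; no; ¬?)

coeff-+P : ∀ p q u → coeff (p +P q) u ≡ coeff p u ℚ.+ coeff q u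
coeff-+P []            q u = sym (ℚₚ.+-identityˡ _)
coeff-+P ((c , v) ∷ p) q u with v ≟W u
... | yes _ = trans (cong (c ℚ.+_) (coeff-+P p q u)) (sym (ℚₚ.+-assoc c _ _))
... | no  _ = coeff-+P p q u

coeff-⋆ : ∀ c p u → coeff (c ⋆ p) u ≡ c ℚ.* coeff p u
coeff-⋆ c []            u = sym (ℚₚ.*-zeroʳ c)
coeff-⋆ c ((a , v) ∷ p) u with v ≟W u
... | yes _ = trans (cong (c ℚ.* a ℚ.+_) (coeff-⋆ c p u)) (sym (ℚₚ.*-distribˡ-+ c a _))
... | no  _ = coeff-⋆ c p u

-- `p ≈ q` unfolds to a Π-type from which p and q cannot be inferred.
infix 4 _≋_
record _≋_ (p q : Poly) : Set where
  constructor ≈⇒≋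
  field ≋⇒≈ : p ≈ q
open _≋_ public

≋-refl : ∀ {p} → p ≋ p
≋-refl = ≈⇒≋ λ _ → refl

≋-reflexive : ∀ {p q} → p ≡ q → p ≋ q
≋-reflexive refl = ≋-refl

≋-sym : ∀ {p q} → p ≋ q → q ≋ p
≋-sym (≈⇒≋ e) = ≈⇒≋ λ u → sym (e u)

≋-trans : ∀ {p q r} → p ≋ q → q ≋ r → p ≋ r
≋-trans (≈⇒≋ e) (≈⇒≋ e′) = ≈⇒≋ λ u → trans (e u) (e′ u)

≋-setoid : Setoid _ _
≋-setoid = record
  { Carrier = Poly ; _≈_ = _≋_
  ; isEquivalence = record { refl = ≋-refl ; sym = ≋-sym ; trans = ≋-trans } }

module ≋-Reasoning = SetoidReasoning ≋-setoid

+P-cong : ∀ {p p′ q q′} → p ≋ p′ → q ≋ q′ → p +P q ≋ p′ +P q′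
+P-cong {p} {p′} {q} {q′} (≈⇒≋ e) (≈⇒≋ e′) = ≈⇒≋ λ u →
  trans (coeff-+P p q u) (trans (cong₂ ℚ._+_ (e u) (e′ u)) (sym (coeff-+P p′ q′ u)))

+P-congˡ : ∀ p {q q′} → q ≋ q′ → p +P q ≋ p +P q′
+P-congˡ p = +P-cong (≋-refl {p})

+P-congʳ : ∀ {p p′} q → p ≋ p′ → p +P q ≋ p′ +P q
+P-congʳ q e = +P-cong e (≋-refl {q})

+P-comm : ∀ p q → p +P q ≋ q +P p
+P-comm p q = ≈⇒≋ λ u →
  trans (coeff-+P p q u) (trans (ℚₚ.+-comm (coeff p u) _) (sym (coeff-+P q p u)))

+P-assoc : ∀ p q r → (p +P q) +P r ≋ p +P (q +P r)
+P-assoc p q r = ≋-reflexive (List.++-assoc p q r)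

+P-identityʳ : ∀ p → p +P 0P ≋ p
+P-identityʳ p = ≋-reflexive (List.++-identityʳ p)

⋆-cong : ∀ c {p q} → p ≋ q → c ⋆ p ≋ c ⋆ q
⋆-cong c {p} {q} (≈⇒≋ e) = ≈⇒≋ λ u →
  trans (coeff-⋆ c p u) (trans (cong (c ℚ.*_) (e u)) (sym (coeff-⋆ c q u)))

⋆-+P : ∀ c p q → c ⋆ (p +P q) ≡ c ⋆ p +P c ⋆ q
⋆-+P c p q = List.map-++ _ p q

⋆-assoc : ∀ c d p → (c ℚ.* d) ⋆ p ≋ c ⋆ (d ⋆ p)
⋆-assoc c d p = ≈⇒≋ λ u → begin
  coeff ((c ℚ.* d) ⋆ p) u   ≡⟨ coeff-⋆ (c ℚ.* d) p u ⟩
  (c ℚ.* d) ℚ.* coeff p u   ≡⟨ ℚₚ.*-assoc c d _ ⟩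
  c ℚ.* (d ℚ.* coeff p u)   ≡⟨ cong (c ℚ.*_) (coeff-⋆ d p u) ⟨
  c ℚ.* coeff (d ⋆ p) u     ≡⟨ coeff-⋆ c (d ⋆ p) u ⟨
  coeff (c ⋆ (d ⋆ p)) u     ∎
  where open ≡-Reasoning

⋆-comm : ∀ c d p → c ⋆ (d ⋆ p) ≋ d ⋆ (c ⋆ p)
⋆-comm c d p = ≋-trans (≋-sym (⋆-assoc c d p)) (≋-trans (≋-reflexive (cong (_⋆ p) (ℚₚ.*-comm c d))) (⋆-assoc d c p))

⋆-identityˡ : ∀ p → 1ℚ ⋆ p ≋ p
⋆-identityˡ p = ≈⇒≋ λ u → trans (coeff-⋆ 1ℚ p u) (ℚₚ.*-identityˡ _)

⋆-zeroˡ : ∀ p → 0ℚ ⋆ p ≋ 0P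
⋆-zeroˡ p = ≈⇒≋ λ u → trans (coeff-⋆ 0ℚ p u) (ℚₚ.*-zeroˡ (coeff p u))

⋆-distribʳ : ∀ c d p → (c ℚ.+ d) ⋆ p ≋ c ⋆ p +P d ⋆ p
⋆-distribʳ c d p = ≈⇒≋ λ u →
  trans (coeff-⋆ (c ℚ.+ d) p u) (trans (ℚₚ.*-distribʳ-+ _ c d)
    (sym (trans (coeff-+P (c ⋆ p) (d ⋆ p) u) (cong₂ ℚ._+_ (coeff-⋆ c p u) (coeff-⋆ d p u)))))

negP-cong : ∀ {p q} → p ≋ q → negP p ≋ negP q
negP-cong = ⋆-cong (- 1ℚ)

-P-cong : ∀ {p p′ q q′} → p ≋ p′ → q ≋ q′ → p -P q ≋ p′ -P q′
-P-cong e e′ = +P-cong e (negP-cong e′)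

-P-inverseʳ : ∀ p → p -P p ≋ 0P
-P-inverseʳ p = ≈⇒≋ λ u → begin
  coeff (p -P p) u                          ≡⟨ coeff-+P p (negP p) u ⟩
  coeff p u ℚ.+ coeff (negP p) u            ≡⟨ cong (coeff p u ℚ.+_) (coeff-⋆ (- 1ℚ) p u) ⟩
  coeff p u ℚ.+ (- 1ℚ) ℚ.* coeff p u        ≡⟨ cong (coeff p u ℚ.+_) (ℚ-1*x≈-x (coeff p u)) ⟩
  coeff p u ℚ.+ - coeff p u                 ≡⟨ ℚₚ.+-inverseʳ (coeff p u) ⟩
  0ℚ                                        ∎
  where
  open ≡-Reasoning
  open Algebra.Properties.Ring ℚₚ.+-*-ring renaming (-1*x≈-x to ℚ-1*x≈-x)

+P-cancelʳ : ∀ p q → (p +P q) -P q ≋ p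
+P-cancelʳ p q = ≋-trans (+P-assoc p q (negP q)) (≋-trans (+P-congˡ p (-P-inverseʳ q)) (+P-identityʳ p))

+P-isAbelianGroup : IsAbelianGroup _≋_ _+P_ 0P negP
+P-isAbelianGroup = record
  { isGroup = record
    { isMonoid = record
      { isSemigroup = record
        { isMagma = record
          { isEquivalence = Setoid.isEquivalence ≋-setoid
          ; ∙-cong = +P-cong }
        ; assoc = +P-assoc }
      ; identity = (λ _ → ≋-refl) , +P-identityʳ }
    ; inverse = (λ p → ≋-trans (+P-comm (negP p) p) (-P-inverseʳ p)) , -P-inverseʳ
    ; ⁻¹-cong = negP-cong }
  ; comm = +P-comm }

+P-abelianGroup : AbelianGroup _ _
+P-abelianGroup = record { isAbelianGroup = +P-isAbelianGroup }

open import Algebra.Properties.CommutativeSemigroup (AbelianGroup.commutativeSemigroup +P-abelianGroup)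
  using (x∙yz≈y∙xz; interchange)
open import Algebra.Properties.AbelianGroup +P-abelianGroup
  using (x∙y⁻¹≈ε⇒x≈y; ⁻¹-involutive; ⁻¹-∙-comm; ⁻¹-anti-homo‿-)
open import Algebra.Solver.CommutativeMonoid (AbelianGroup.commutativeMonoid +P-abelianGroup) using (solve; _⊜_; _⊕_)

lin-+ʳ : ∀ g p q → lin g (p +P q) ≡ lin g p +P lin g q
lin-+ʳ g []            q = refl
lin-+ʳ g ((c , u) ∷ p) q =
  trans (cong (c ⋆ g u ++_) (lin-+ʳ g p q)) (sym (List.++-assoc (c ⋆ g u) (lin g p) (lin g q)))

lin-⋆ʳ : ∀ g c p → lin g (c ⋆ p) ≋ c ⋆ lin g p
lin-⋆ʳ g c []            = ≋-refl
lin-⋆ʳ g c ((a , u) ∷ p) = ≋-trans (+P-cong (⋆-assoc c a (g u)) (lin-⋆ʳ g c p))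
                                  (≋-reflexive (sym (⋆-+P c (a ⋆ g u) (lin g p))))

lin-congˡ : ∀ {g h} → (∀ u → g u ≋ h u) → ∀ p → lin g p ≋ lin h p
lin-congˡ g≋h []            = ≋-refl
lin-congˡ g≋h ((c , u) ∷ p) = +P-cong (⋆-cong c (g≋h u)) (lin-congˡ g≋h p)

dropWord : Word → Poly → Poly
dropWord u = filter (λ t → ¬? (proj₂ t ≟W u))

coeff-∷-≢ : ∀ d {v u} r → v ≢ u → coeff ((d , v) ∷ r) u ≡ coeff r u
coeff-∷-≢ d {v} {u} r v≢u with v ≟W u
... | yes v≡u = ⊥-elim (v≢u v≡u)
... | no  _   = refl

coeff-dropWord-≡ : ∀ u r → coeff (dropWord u r) u ≡ 0ℚ
coeff-dropWord-≡ u []            = refl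
coeff-dropWord-≡ u ((d , v) ∷ r) with v ≟W u
... | yes _   = coeff-dropWord-≡ u r
... | no  v≢u = trans (coeff-∷-≢ d (dropWord u r) v≢u) (coeff-dropWord-≡ u r)

coeff-dropWord-≢ : ∀ u r w → u ≢ w → coeff (dropWord u r) w ≡ coeff r w
coeff-dropWord-≢ u []            w u≢w = refl
coeff-dropWord-≢ u ((d , v) ∷ r) w u≢w with v ≟W u
... | yes refl = trans (coeff-dropWord-≢ u r w u≢w) (sym (coeff-∷-≢ d r u≢w))
... | no  _    = trans (coeff-+P ((d , v) ∷ []) (dropWord u r) w)
                   (trans (cong (coeff ((d , v) ∷ []) w ℚ.+_) (coeff-dropWord-≢ u r w u≢w))
                     (sym (coeff-+P ((d , v) ∷ []) r w)))

lin-split : ∀ g u r → lin g r ≋ coeff r u ⋆ g u +P lin g (dropWord u r)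
lin-split g u [] = ≋-sym (≋-trans (+P-identityʳ _) (⋆-zeroˡ (g u)))
lin-split g u ((d , v) ∷ r) with v ≟W u
... | yes refl = begin
  d ⋆ g v +P lin g r                                         ≈⟨ +P-congˡ (d ⋆ g v) (lin-split g v r) ⟩
  d ⋆ g v +P (coeff r v ⋆ g v +P lin g (dropWord v r))       ≈⟨ +P-assoc (d ⋆ g v) _ _ ⟨
  (d ⋆ g v +P coeff r v ⋆ g v) +P lin g (dropWord v r)       ≈⟨ +P-congʳ _ (⋆-distribʳ d _ (g v)) ⟨
  (d ℚ.+ coeff r v) ⋆ g v +P lin g (dropWord v r)            ∎
  where open ≋-Reasoning
... | no _ = ≋-trans (+P-congˡ (d ⋆ g v) (lin-split g u r)) (x∙yz≈y∙xz (d ⋆ g v) (coeff r u ⋆ g u) _)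

-- lin g is additive, so it respects ≈ once it kills every representative r of 0P. Split off the
-- monomials of r carrying its first word u: their coefficients add up to coeff r u = 0, and the rest is shorter.
lin-annihilates : ∀ g n r → length r ≤ n → r ≋ 0P → lin g r ≋ 0P
lin-annihilates g n       []               _            _   = ≋-refl
lin-annihilates g (suc n) r@((c , u) ∷ r′) (s≤s |r′|≤n) r≋0 = begin
  lin g r                                  ≈⟨ lin-split g u r ⟩
  coeff r u ⋆ g u +P lin g (dropWord u r)  ≈⟨ +P-cong u-term≋0 (lin-annihilates g n (dropWord u r) |dropped|≤n dropped≋0) ⟩
  0P                                       ∎
  where
  open ≋-Reasoning
  u-term≋0 : coeff r u ⋆ g u ≋ 0P
  u-term≋0 = ≋-trans (≋-reflexive (cong (_⋆ g u) (≋⇒≈ r≋0 u))) (⋆-zeroˡ (g u))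
  dropped≋0 : dropWord u r ≋ 0P
  dropped≋0 = ≈⇒≋ λ w → at w (u ≟W w)
    where
    at : ∀ w → Dec (u ≡ w) → coeff (dropWord u r) w ≡ 0ℚ
    at w (yes refl) = coeff-dropWord-≡ u r
    at w (no u≢w)   = trans (coeff-dropWord-≢ u r w u≢w) (≋⇒≈ r≋0 w)
  |dropped|≤n : length (dropWord u r) ≤ n
  |dropped|≤n = subst (λ l → length l ≤ n) (sym (List.filter-reject (λ t → ¬? (proj₂ t ≟W u)) (λ u≢u → u≢u refl)))
                  (ℕ.≤-trans (List.length-filter (λ t → ¬? (proj₂ t ≟W u)) r′) |r′|≤n)

lin-congʳ : ∀ g {p q} → p ≋ q → lin g p ≋ lin g q
lin-congʳ g {p} {q} p≋q = x∙y⁻¹≈ε⇒x≈y (lin g p) (lin g q) (begin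
  lin g p -P lin g q         ≈⟨ +P-congˡ (lin g p) (lin-⋆ʳ g (- 1ℚ) q) ⟨
  lin g p +P lin g (negP q)  ≡⟨ lin-+ʳ g p (negP q) ⟨
  lin g (p -P q)             ≈⟨ lin-annihilates g _ (p -P q) ℕ.≤-refl (≋-trans (+P-congʳ (negP q) p≋q) (-P-inverseʳ q)) ⟩
  0P                         ∎)
  where open ≋-Reasoning

lin-⋆ˡ : ∀ c g p → lin (λ u → c ⋆ g u) p ≋ c ⋆ lin g p
lin-⋆ˡ c g []            = ≋-refl
lin-⋆ˡ c g ((d , u) ∷ p) =
  ≋-trans (+P-cong (⋆-comm d c (g u)) (lin-⋆ˡ c g p)) (≋-reflexive (sym (⋆-+P c (d ⋆ g u) (lin g p))))

lin-+ˡ : ∀ g h p → lin (λ u → g u +P h u) p ≋ lin g p +P lin h p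
lin-+ˡ g h []            = ≋-refl
lin-+ˡ g h ((c , u) ∷ p) = begin
  c ⋆ (g u +P h u) +P lin (λ u → g u +P h u) p   ≈⟨ +P-cong (≋-reflexive (⋆-+P c (g u) (h u))) (lin-+ˡ g h p) ⟩
  (c ⋆ g u +P c ⋆ h u) +P (lin g p +P lin h p)   ≈⟨ interchange (c ⋆ g u) (c ⋆ h u) (lin g p) (lin h p) ⟩
  (c ⋆ g u +P lin g p) +P (c ⋆ h u +P lin h p)   ∎
  where open ≋-Reasoning

lin-0ˡ : ∀ p → lin (λ _ → 0P) p ≡ 0P
lin-0ˡ []            = refl
lin-0ˡ ((c , u) ∷ p) = lin-0ˡ p

lin-word : ∀ g u → lin g (wordP u) ≋ g u
lin-word g u = ≋-trans (+P-identityʳ (1ℚ ⋆ g u)) (⋆-identityˡ (g u))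

lin-wordP : ∀ p → lin wordP p ≡ p
lin-wordP []            = refl
lin-wordP ((c , u) ∷ p) = cong₂ (λ c′ p′ → (c′ , u) ∷ p′) (ℚₚ.*-identityʳ c) (lin-wordP p)

lin-interchange : ∀ (g : Word → Word → Poly) p q → lin (λ u → lin (g u) q) p ≋ lin (λ v → lin (λ u → g u v) p) q
lin-interchange g []            q = ≋-reflexive (sym (lin-0ˡ q))
lin-interchange g ((c , u) ∷ p) q = begin
  c ⋆ lin (g u) q +P lin (λ u → lin (g u) q) p
    ≈⟨ +P-cong (≋-sym (lin-⋆ˡ c (g u) q)) (lin-interchange g p q) ⟩
  lin (λ v → c ⋆ g u v) q +P lin (λ v → lin (λ u → g u v) p) q
    ≈⟨ lin-+ˡ (λ v → c ⋆ g u v) (λ v → lin (λ u → g u v) p) q ⟨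
  lin (λ v → c ⋆ g u v +P lin (λ u → g u v) p) q
    ∎
  where open ≋-Reasoning

record IsLinear (L : Poly → Poly) : Set where
  field
    cong-≋  : ∀ {p q} → p ≋ q → L p ≋ L q
    +P-homo : ∀ p q → L (p +P q) ≋ L p +P L q
    ⋆-homo  : ∀ c p → L (c ⋆ p) ≋ c ⋆ L p

  0P-homo : L 0P ≋ 0P
  0P-homo = ≋-trans (⋆-homo 0ℚ 0P) (⋆-zeroˡ (L 0P))

  negP-homo : ∀ p → L (negP p) ≋ negP (L p)
  negP-homo = ⋆-homo (- 1ℚ)

  -P-homo : ∀ p q → L (p -P q) ≋ L p -P L q
  -P-homo p q = ≋-trans (+P-homo p (negP q)) (+P-congˡ (L p) (negP-homo q))

  lin-homo : ∀ g p → L (lin g p) ≋ lin (L ∘ g) p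
  lin-homo g []            = 0P-homo
  lin-homo g ((c , u) ∷ p) = ≋-trans (+P-homo (c ⋆ g u) (lin g p)) (+P-cong (⋆-homo c (g u)) (lin-homo g p))

  sumP-homo : ∀ ps → L (sumP ps) ≋ sumP (map L ps)
  sumP-homo []       = 0P-homo
  sumP-homo (p ∷ ps) = ≋-trans (+P-homo p (sumP ps)) (+P-congˡ (L p) (sumP-homo ps))

  bilin-homo : ∀ g p q → L (bilin g p q) ≋ bilin (λ u v → L (g u v)) p q
  bilin-homo g p q = ≋-trans (lin-homo (λ u → lin (g u) q) p) (lin-congˡ (λ u → lin-homo (g u) q) p)

lin-isLinear : ∀ g → IsLinear (lin g)
lin-isLinear g = record
  { cong-≋ = lin-congʳ g ; +P-homo = λ p q → ≋-reflexive (lin-+ʳ g p q) ; ⋆-homo = lin-⋆ʳ g }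

∘-isLinear : ∀ {L M} → IsLinear L → IsLinear M → IsLinear (L ∘ M)
∘-isLinear {L} {M} L-lin M-lin = record
  { cong-≋  = λ e → L.cong-≋ (M.cong-≋ e)
  ; +P-homo = λ p q → ≋-trans (L.cong-≋ (M.+P-homo p q)) (L.+P-homo (M p) (M q))
  ; ⋆-homo  = λ c p → ≋-trans (L.cong-≋ (M.⋆-homo c p)) (L.⋆-homo c (M p)) }
  where
  module L = IsLinear L-lin
  module M = IsLinear M-lin

IsLinear-resp : ∀ {L M} → (∀ p → L p ≋ M p) → IsLinear M → IsLinear L
IsLinear-resp {L} {M} L≋M M-lin = record
  { cong-≋  = λ {p} {q} e → ≋-trans (L≋M p) (≋-trans (M.cong-≋ e) (≋-sym (L≋M q)))
  ; +P-homo = λ p q → ≋-trans (L≋M (p +P q)) (≋-trans (M.+P-homo p q) (≋-sym (+P-cong (L≋M p) (L≋M q))))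
  ; ⋆-homo  = λ c p → ≋-trans (L≋M (c ⋆ p)) (≋-trans (M.⋆-homo c p) (≋-sym (⋆-cong c (L≋M p)))) }
  where module M = IsLinear M-lin

⋆-isLinear : ∀ c → IsLinear (c ⋆_)
⋆-isLinear c = record { cong-≋ = ⋆-cong c ; +P-homo = λ p q → ≋-reflexive (⋆-+P c p q) ; ⋆-homo = λ d p → ⋆-comm c d p }

negP-isLinear : IsLinear negP
negP-isLinear = ⋆-isLinear (- 1ℚ)

-P-+P-interchange : ∀ a b c d → (a +P b) -P (c +P d) ≋ (a -P c) +P (b -P d)
-P-+P-interchange a b c d = begin
  (a +P b) +P negP (c +P d)          ≈⟨ +P-congˡ (a +P b) (⁻¹-∙-comm c d) ⟨
  (a +P b) +P (negP c +P negP d)     ≈⟨ interchange a b (negP c) (negP d) ⟩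
  (a -P c) +P (b -P d)               ∎
  where open ≋-Reasoning

-P-isLinear : ∀ {L M} → IsLinear L → IsLinear M → IsLinear (λ p → L p -P M p)
-P-isLinear {L} {M} L-lin M-lin = record
  { cong-≋  = λ e → -P-cong (L.cong-≋ e) (M.cong-≋ e)
  ; +P-homo = λ p q → ≋-trans (-P-cong (L.+P-homo p q) (M.+P-homo p q)) (-P-+P-interchange (L p) (L q) (M p) (M q))
  ; ⋆-homo  = λ c p → ≋-trans (-P-cong (L.⋆-homo c p) (M.⋆-homo c p)) (≋-sym (IsLinear.-P-homo (⋆-isLinear c) (L p) (M p))) }
  where
  module L = IsLinear L-lin
  module M = IsLinear M-lin

lin-lin : ∀ g h p → lin g (lin h p) ≋ lin (λ u → lin g (h u)) p
lin-lin g = IsLinear.lin-homo (lin-isLinear g)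

bilin-isLinearˡ : ∀ g q → IsLinear (λ p → bilin g p q)
bilin-isLinearˡ g q = lin-isLinear (λ u → lin (g u) q)

bilin-isLinearʳ : ∀ g p → IsLinear (bilin g p)
bilin-isLinearʳ g p = record
  { cong-≋  = λ e → lin-congˡ (λ u → lin-congʳ (g u) e) p
  ; +P-homo = λ q q′ → ≋-trans (lin-congˡ (λ u → ≋-reflexive (lin-+ʳ (g u) q q′)) p)
                                (lin-+ˡ (λ u → lin (g u) q) (λ u → lin (g u) q′) p)
  ; ⋆-homo  = λ c q → ≋-trans (lin-congˡ (λ u → lin-⋆ʳ (g u) c q) p) (lin-⋆ˡ c (λ u → lin (g u) q) p) }

bilin-cong : ∀ g {p p′ q q′} → p ≋ p′ → q ≋ q′ → bilin g p q ≋ bilin g p′ q′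
bilin-cong g {p′ = p′} {q} p≋p′ q≋q′ =
  ≋-trans (IsLinear.cong-≋ (bilin-isLinearˡ g q) p≋p′) (IsLinear.cong-≋ (bilin-isLinearʳ g p′) q≋q′)

bilin-congᶠ : ∀ {g h : Word → Word → Poly} → (∀ u v → g u v ≋ h u v) → ∀ p q → bilin g p q ≋ bilin h p q
bilin-congᶠ g≋h p q = lin-congˡ (λ u → lin-congˡ (g≋h u) q) p

bilin-+P : ∀ g h p q → bilin (λ u v → g u v +P h u v) p q ≋ bilin g p q +P bilin h p q
bilin-+P g h p q = ≋-trans (lin-congˡ (λ u → lin-+ˡ (g u) (h u) q) p) (lin-+ˡ (λ u → lin (g u) q) (λ u → lin (h u) q) p)

concatW : Word → Word → Poly
concatW u v = wordP (u ++ v)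

·P-bilin : ∀ p q → p ·P q ≋ bilin concatW p q
·P-bilin []            q = ≋-refl
·P-bilin ((a , u) ∷ p) q = ≋-trans (≋-reflexive (cong (_++ p ·P q) (sym (List.++-identityʳ _))))
                                   (+P-cong (≋-reflexive (monomial-·P q)) (·P-bilin p q))
  where
  monomial-·P : ∀ q → ((a , u) ∷ []) ·P q ≡ a ⋆ lin (concatW u) q
  monomial-·P []            = refl
  monomial-·P ((b , v) ∷ q) =
    cong₂ (λ c r → (c , u ++ v) ∷ r) (cong (a ℚ.*_) (sym (ℚₚ.*-identityʳ b))) (monomial-·P q)

wordP-·P-lin : ∀ u q → wordP u ·P q ≋ lin (concatW u) q
wordP-·P-lin u q = ≋-trans (·P-bilin (wordP u) q) (lin-word (λ u → lin (concatW u) q) u)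

·P-isLinearˡ : ∀ q → IsLinear (_·P q)
·P-isLinearˡ q = IsLinear-resp (λ p → ·P-bilin p q) (bilin-isLinearˡ concatW q)

·P-isLinearʳ : ∀ p → IsLinear (p ·P_)
·P-isLinearʳ p = IsLinear-resp (·P-bilin p) (bilin-isLinearʳ concatW p)

·P-congˡ : ∀ p {q q′} → q ≋ q′ → p ·P q ≋ p ·P q′
·P-congˡ p = IsLinear.cong-≋ (·P-isLinearʳ p)

·P-congʳ : ∀ {p p′} q → p ≋ p′ → p ·P q ≋ p′ ·P q
·P-congʳ q = IsLinear.cong-≋ (·P-isLinearˡ q)

·P-cong : ∀ {p p′ q q′} → p ≋ p′ → q ≋ q′ → p ·P q ≋ p′ ·P q′
·P-cong {p′ = p′} {q} e e′ = ≋-trans (·P-congʳ q e) (·P-congˡ p′ e′)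

lin-concatW : ∀ g u q → lin g (lin (concatW u) q) ≋ lin (λ v → g (u ++ v)) q
lin-concatW g u q = ≋-trans (lin-lin g (concatW u) q) (lin-congˡ (λ v → lin-word g (u ++ v)) q)

·P-assoc : ∀ p q r → (p ·P q) ·P r ≋ p ·P (q ·P r)
·P-assoc p q r = begin
  (p ·P q) ·P r                                    ≈⟨ ·P-bilin (p ·P q) r ⟩
  lin G (p ·P q)                                   ≈⟨ lin-congʳ G (·P-bilin p q) ⟩
  lin G (lin (λ u → lin (concatW u) q) p)          ≈⟨ lin-lin G (λ u → lin (concatW u) q) p ⟩
  lin (λ u → lin G (lin (concatW u) q)) p          ≈⟨ lin-congˡ (λ u → lin-concatW G u q) p ⟩
  lin (λ u → lin (λ v → G (u ++ v)) q) p
    ≈⟨ lin-congˡ (λ u → lin-congˡ (λ v → lin-congˡ (λ t → ≋-reflexive (cong wordP (List.++-assoc u v t))) r) q) p ⟩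
  lin (λ u → lin (λ v → lin (λ t → concatW u (v ++ t)) r) q) p
    ≈⟨ lin-congˡ (λ u → lin-congˡ (λ v → lin-concatW (concatW u) v r) q) p ⟨
  lin (λ u → lin (λ v → lin (concatW u) (lin (concatW v) r)) q) p
    ≈⟨ lin-congˡ (λ u → lin-lin (concatW u) (λ v → lin (concatW v) r) q) p ⟨
  lin (λ u → lin (concatW u) (bilin concatW q r)) p ≈⟨ lin-congˡ (λ u → lin-congʳ (concatW u) (·P-bilin q r)) p ⟨
  lin (λ u → lin (concatW u) (q ·P r)) p           ≈⟨ ·P-bilin p (q ·P r) ⟨
  p ·P (q ·P r)                                    ∎
  where
  open ≋-Reasoning
  G : Word → Poly
  G t = lin (concatW t) r

·P-identityˡ : ∀ p → 1P ·P p ≋ p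
·P-identityˡ p = ≋-trans (wordP-·P-lin [] p) (≋-reflexive (lin-wordP p))

·P-identityʳ : ∀ p → p ·P 1P ≋ p
·P-identityʳ p = begin
  p ·P 1P                         ≈⟨ ·P-bilin p 1P ⟩
  lin (λ u → lin (concatW u) 1P) p ≈⟨ lin-congˡ (λ u → lin-word (concatW u) []) p ⟩
  lin (λ u → wordP (u ++ [])) p   ≈⟨ lin-congˡ (λ u → ≋-reflexive (cong wordP (List.++-identityʳ u))) p ⟩
  lin wordP p                     ≡⟨ lin-wordP p ⟩
  p                               ∎
  where open ≋-Reasoning

polyRing : Ring _ _
polyRing = record
  { _+_ = _+P_ ; _*_ = _·P_ ; -_ = negP ; 0# = 0P ; 1# = 1P
  ; isRing = record
    { +-isAbelianGroup = +P-isAbelianGroup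
    ; *-cong     = ·P-cong
    ; *-assoc    = ·P-assoc
    ; *-identity = ·P-identityˡ , ·P-identityʳ
    ; distrib    = (λ p → IsLinear.+P-homo (·P-isLinearʳ p)) , (λ p → IsLinear.+P-homo (·P-isLinearˡ p)) } }

open Algebra.Properties.Ring polyRing using (-‿distribˡ-*; -‿distribʳ-*)

powP-comm : ∀ p n → p ·P powP p n ≋ powP p n ·P p
powP-comm p zero    = ≋-trans (·P-identityʳ p) (≋-sym (·P-identityˡ p))
powP-comm p (suc n) = ≋-trans (·P-congˡ p (powP-comm p n)) (≋-sym (·P-assoc p (powP p n) p))

wordP-·P : ∀ u v → wordP u ·P wordP v ≋ wordP (u ++ v)
wordP-·P u v = ≋-trans (wordP-·P-lin u (wordP v)) (lin-word (concatW u) v)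

bilin-shiftˡ : ∀ g a p q → bilin g (wordP a ·P p) q ≋ bilin (λ u → g (a ++ u)) p q
bilin-shiftˡ g a p q = ≋-trans (lin-congʳ (λ u → lin (g u) q) (wordP-·P-lin a p)) (lin-concatW (λ u → lin (g u) q) a p)

bilin-shiftʳ : ∀ g b p q → bilin g p (wordP b ·P q) ≋ bilin (λ u v → g u (b ++ v)) p q
bilin-shiftʳ g b p q = lin-congˡ (λ u → ≋-trans (lin-congʳ (g u) (wordP-·P-lin b q)) (lin-concatW (g u) b q)) p

bilin-·P : ∀ r g p q → bilin (λ u v → r ·P g u v) p q ≋ r ·P bilin g p q
bilin-·P r g p q = ≋-sym (IsLinear.bilin-homo (·P-isLinearʳ r) g p q)

lin-·P-lin : ∀ g h p q → lin g p ·P lin h q ≋ bilin (λ u v → g u ·P h v) p q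
lin-·P-lin g h p q =
  ≋-trans (IsLinear.lin-homo (·P-isLinearˡ (lin h q)) g p)
          (lin-congˡ (λ u → IsLinear.lin-homo (·P-isLinearʳ (g u)) h q) p)

lin-·P-homo : ∀ g → (∀ u v → g (u ++ v) ≋ g u ·P g v) → ∀ p q → lin g (p ·P q) ≋ lin g p ·P lin g q
lin-·P-homo g g-homo p q = begin
  lin g (p ·P q)                            ≈⟨ lin-congʳ g (·P-bilin p q) ⟩
  lin g (bilin concatW p q)                 ≈⟨ IsLinear.bilin-homo (lin-isLinear g) concatW p q ⟩
  bilin (λ u v → lin g (concatW u v)) p q   ≈⟨ bilin-congᶠ (λ u v → ≋-trans (lin-word g (u ++ v)) (g-homo u v)) p q ⟩
  bilin (λ u v → g u ·P g v) p q            ≈⟨ lin-·P-lin g g p q ⟨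
  lin g p ·P lin g q                        ∎
  where open ≋-Reasoning

lin-·P-antihomo : ∀ g → (∀ u v → g (u ++ v) ≋ g v ·P g u) → ∀ p q → lin g (p ·P q) ≋ lin g q ·P lin g p
lin-·P-antihomo g g-antihomo p q = begin
  lin g (p ·P q)                            ≈⟨ lin-congʳ g (·P-bilin p q) ⟩
  lin g (bilin concatW p q)                 ≈⟨ IsLinear.bilin-homo (lin-isLinear g) concatW p q ⟩
  bilin (λ u v → lin g (concatW u v)) p q   ≈⟨ bilin-congᶠ (λ u v → ≋-trans (lin-word g (u ++ v)) (g-antihomo u v)) p q ⟩
  bilin (λ u v → g v ·P g u) p q            ≈⟨ lin-interchange (λ u v → g v ·P g u) p q ⟩
  bilin (λ v u → g v ·P g u) q p            ≈⟨ lin-·P-lin g g q p ⟨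
  lin g q ·P lin g p                        ∎
  where open ≋-Reasoning

φ-isLinear : IsLinear φ
φ-isLinear = lin-isLinear φWord

φ-cong : ∀ {p q} → p ≋ q → φ p ≋ φ q
φ-cong = IsLinear.cong-≋ φ-isLinear

φWord-++ : ∀ u v → φWord (u ++ v) ≋ φWord u ·P φWord v
φWord-++ []      v = ≋-sym (·P-identityˡ (φWord v))
φWord-++ (a ∷ u) v =
  ≋-trans (·P-congˡ (φLetter a) (φWord-++ u v)) (≋-sym (·P-assoc (φLetter a) (φWord u) (φWord v)))

φ-·P : ∀ p q → φ (p ·P q) ≋ φ p ·P φ q
φ-·P = lin-·P-homo φWord φWord-++

zP : Poly
zP = xP +P yP

φ-1 : φ 1P ≋ 1P
φ-1 = lin-word φWord []

φ-x : φ xP ≋ zP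
φ-x = ≋-trans (lin-word φWord (X ∷ [])) (·P-identityʳ zP)

φ-y : φ yP ≋ negP yP
φ-y = ≋-trans (lin-word φWord (Y ∷ [])) (·P-identityʳ (negP yP))

φ-z : φ zP ≋ xP
φ-z = ≋-trans (IsLinear.+P-homo φ-isLinear xP yP) (≋-trans (+P-cong φ-x φ-y) (+P-cancelʳ xP yP))

φ-involutive : ∀ p → φ (φ p) ≋ p
φ-involutive p = ≋-trans (lin-lin φWord φWord p) (≋-trans (lin-congˡ φ-φWord p) (≋-reflexive (lin-wordP p)))
  where
  φ-φLetter : ∀ a → φ (φLetter a) ≋ wordP (a ∷ [])
  φ-φLetter X = φ-z
  φ-φLetter Y = ≋-trans (IsLinear.negP-homo φ-isLinear yP) (≋-trans (negP-cong φ-y) (⁻¹-involutive yP))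
  φ-φWord : ∀ u → φ (φWord u) ≋ wordP u
  φ-φWord []      = φ-1
  φ-φWord (a ∷ u) = ≋-trans (φ-·P (φLetter a) (φWord u))
                      (≋-trans (·P-cong (φ-φLetter a) (φ-φWord u)) (wordP-·P (a ∷ []) u))

harmW-identityʳ : ∀ u → harmW u [] ≡ wordP u
harmW-identityʳ []      = refl
harmW-identityʳ (_ ∷ _) = refl

harmW-xˡ : ∀ u v → harmW (X ∷ u) v ≋ xP ·P harmW u v
harmW-xˡ u []      = ≋-trans (≋-sym (wordP-·P (X ∷ []) u)) (·P-congˡ xP (≋-reflexive (sym (harmW-identityʳ u))))
harmW-xˡ u (_ ∷ _) = ≋-refl

harmW-xʳ : ∀ u v → harmW u (X ∷ v) ≋ xP ·P harmW u v
harmW-xʳ []      v = ≋-sym (wordP-·P (X ∷ []) v)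
harmW-xʳ (X ∷ u) v = ≋-trans (·P-congˡ xP (harmW-xʳ u v)) (·P-congˡ xP (≋-sym (harmW-xˡ u v)))
harmW-xʳ (Y ∷ u) v = ≋-refl

✱-isLinearʳ : ∀ p → IsLinear (p ✱_)
✱-isLinearʳ = bilin-isLinearʳ harmW

✱-isLinearˡ : ∀ q → IsLinear (_✱ q)
✱-isLinearˡ = bilin-isLinearˡ harmW

✱-cong : ∀ {p p′ q q′} → p ≋ p′ → q ≋ q′ → p ✱ q ≋ p′ ✱ q′
✱-cong = bilin-cong harmW

✱-congˡ : ∀ p {q q′} → q ≋ q′ → p ✱ q ≋ p ✱ q′
✱-congˡ p = ✱-cong (≋-refl {p})

✱-congʳ : ∀ {p p′} q → p ≋ p′ → p ✱ q ≋ p′ ✱ q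
✱-congʳ q e = ✱-cong e (≋-refl {q})

✱-identityˡ : ∀ q → 1P ✱ q ≋ q
✱-identityˡ q = ≋-trans (lin-word (λ u → lin (harmW u) q) []) (≋-reflexive (lin-wordP q))

✱-identityʳ : ∀ p → p ✱ 1P ≋ p
✱-identityʳ p = ≋-trans (lin-congˡ (λ u → ≋-trans (lin-word (harmW u) []) (≋-reflexive (harmW-identityʳ u))) p)
                        (≋-reflexive (lin-wordP p))

✱-xʳ : ∀ p q → p ✱ (xP ·P q) ≋ xP ·P (p ✱ q)
✱-xʳ p q = ≋-trans (bilin-shiftʳ harmW (X ∷ []) p q)
             (≋-trans (bilin-congᶠ harmW-xʳ p q) (bilin-·P xP harmW p q))

✱-y : ∀ p q → (yP ·P p) ✱ (yP ·P q) ≋ yP ·P (p ✱ (yP ·P q)) +P yP ·P ((yP ·P p) ✱ q) +P (yP ·P xP) ·P (p ✱ q)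
✱-y p q = begin
  (yP ·P p) ✱ (yP ·P q)                                 ≈⟨ bilin-shiftˡ harmW (Y ∷ []) p (yP ·P q) ⟩
  bilin (λ u → harmW (Y ∷ u)) p (yP ·P q)               ≈⟨ bilin-shiftʳ (λ u → harmW (Y ∷ u)) (Y ∷ []) p q ⟩
  bilin (λ u v → harmW (Y ∷ u) (Y ∷ v)) p q             ≈⟨ bilin-+P (λ u v → A u v +P B u v) C p q ⟩
  bilin (λ u v → A u v +P B u v) p q +P bilin C p q     ≈⟨ +P-congʳ (bilin C p q) (bilin-+P A B p q) ⟩
  bilin A p q +P bilin B p q +P bilin C p q             ≈⟨ +P-cong (+P-cong A-term B-term) (bilin-·P (yP ·P xP) harmW p q) ⟩
  yP ·P (p ✱ (yP ·P q)) +P yP ·P ((yP ·P p) ✱ q) +P (yP ·P xP) ·P (p ✱ q) ∎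
  where
  open ≋-Reasoning
  A B C : Word → Word → Poly
  A u v = yP ·P harmW u (Y ∷ v)
  B u v = yP ·P harmW (Y ∷ u) v
  C u v = (yP ·P xP) ·P harmW u v
  A-term : bilin A p q ≋ yP ·P (p ✱ (yP ·P q))
  A-term = ≋-trans (bilin-·P yP (λ u v → harmW u (Y ∷ v)) p q)
                   (·P-congˡ yP (≋-sym (bilin-shiftʳ harmW (Y ∷ []) p q)))
  B-term : bilin B p q ≋ yP ·P ((yP ·P p) ✱ q)
  B-term = ≋-trans (bilin-·P yP (λ u v → harmW (Y ∷ u) v) p q)
                   (·P-congˡ yP (≋-sym (bilin-shiftˡ harmW (Y ∷ []) p q)))

✱-negP : ∀ p q → negP p ✱ negP q ≋ p ✱ q
✱-negP p q = begin
  negP p ✱ negP q      ≈⟨ IsLinear.negP-homo (✱-isLinearˡ (negP q)) p ⟩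
  negP (p ✱ negP q)    ≈⟨ negP-cong (IsLinear.negP-homo (✱-isLinearʳ p) q) ⟩
  negP (negP (p ✱ q))  ≈⟨ ⁻¹-involutive (p ✱ q) ⟩
  p ✱ q                ∎
  where open ≋-Reasoning

◇-isLinearʳ : ∀ a → IsLinear (a ◇_)
◇-isLinearʳ a = ∘-isLinear φ-isLinear (∘-isLinear (✱-isLinearʳ (φ a)) φ-isLinear)

◇-identityˡ : ∀ b → 1P ◇ b ≋ b
◇-identityˡ b = ≋-trans (φ-cong (≋-trans (✱-congʳ (φ b) φ-1) (✱-identityˡ (φ b))))
                        (φ-involutive b)

◇-identityʳ : ∀ a → a ◇ 1P ≋ a
◇-identityʳ a = ≋-trans (φ-cong (≋-trans (✱-congˡ (φ a) φ-1) (✱-identityʳ (φ a))))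
                        (φ-involutive a)

◇-zʳ : ∀ a b → a ◇ (zP ·P b) ≋ zP ·P (a ◇ b)
◇-zʳ a b = begin
  φ (φ a ✱ φ (zP ·P b))  ≈⟨ φ-cong (✱-congˡ (φ a) (≋-trans (φ-·P zP b) (·P-congʳ (φ b) φ-z))) ⟩
  φ (φ a ✱ (xP ·P φ b))  ≈⟨ φ-cong (✱-xʳ (φ a) (φ b)) ⟩
  φ (xP ·P (φ a ✱ φ b))  ≈⟨ φ-·P xP (φ a ✱ φ b) ⟩
  φ xP ·P (a ◇ b)        ≈⟨ ·P-congʳ (a ◇ b) φ-x ⟩
  zP ·P (a ◇ b)          ∎
  where open ≋-Reasoning

φ-y· : ∀ c → φ (yP ·P c) ≋ negP (yP ·P φ c)
φ-y· c = ≋-trans (φ-·P yP c) (≋-trans (·P-congʳ (φ c) φ-y) (≋-sym (-‿distribˡ-* yP (φ c))))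

y·φ : ∀ c → yP ·P φ c ≋ negP (φ (yP ·P c))
y·φ c = ≋-trans (≋-sym (⁻¹-involutive (yP ·P φ c))) (negP-cong (≋-sym (φ-y· c)))

φ-y·negP : ∀ c → φ (yP ·P negP c) ≋ yP ·P φ c
φ-y·negP c = begin
  φ (yP ·P negP c)           ≈⟨ φ-y· (negP c) ⟩
  negP (yP ·P φ (negP c))    ≈⟨ negP-cong (·P-congˡ yP (IsLinear.negP-homo φ-isLinear c)) ⟩
  negP (yP ·P negP (φ c))    ≈⟨ negP-cong (-‿distribʳ-* yP (φ c)) ⟨
  negP (negP (yP ·P φ c))    ≈⟨ ⁻¹-involutive (yP ·P φ c) ⟩
  yP ·P φ c                  ∎
  where open ≋-Reasoning

-- φ(y) = −y, so the signs coming from φ(ya) and φ(yb) cancel and ✱-y passes through φ.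
◇-y : ∀ a b → (yP ·P a) ◇ (yP ·P b) ≋ yP ·P (a ◇ (yP ·P b)) +P yP ·P ((yP ·P a) ◇ b) -P (yP ·P zP) ·P (a ◇ b)
◇-y a b = begin
  φ (φ (yP ·P a) ✱ φ (yP ·P b))              ≈⟨ φ-cong (≋-trans (✱-cong (φ-y· a) (φ-y· b)) (✱-negP (yP ·P A) (yP ·P B))) ⟩
  φ ((yP ·P A) ✱ (yP ·P B))                  ≈⟨ φ-cong (✱-y A B) ⟩
  φ (T₁ +P T₂ +P T₃)                          ≈⟨ ≋-trans (φ-+P (T₁ +P T₂) T₃) (+P-congʳ (φ T₃) (φ-+P T₁ T₂)) ⟩
  φ T₁ +P φ T₂ +P φ T₃                        ≈⟨ +P-cong (+P-cong T₁-image T₂-image) T₃-image ⟩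
  yP ·P (a ◇ (yP ·P b)) +P yP ·P ((yP ·P a) ◇ b) -P (yP ·P zP) ·P (a ◇ b) ∎
  where
  open ≋-Reasoning
  φ-+P = IsLinear.+P-homo φ-isLinear
  A = φ a
  B = φ b
  T₁ = yP ·P (A ✱ (yP ·P B))
  T₂ = yP ·P ((yP ·P A) ✱ B)
  T₃ = (yP ·P xP) ·P (A ✱ B)
  T₁-image : φ T₁ ≋ yP ·P (a ◇ (yP ·P b))
  T₁-image = ≋-trans (φ-cong (·P-congˡ yP
               (≋-trans (IsLinear.cong-≋ (✱-isLinearʳ A) (y·φ b)) (IsLinear.negP-homo (✱-isLinearʳ A) (φ (yP ·P b))))))
               (φ-y·negP (A ✱ φ (yP ·P b)))
  T₂-image : φ T₂ ≋ yP ·P ((yP ·P a) ◇ b)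
  T₂-image = ≋-trans (φ-cong (·P-congˡ yP
               (≋-trans (IsLinear.cong-≋ (✱-isLinearˡ B) (y·φ a)) (IsLinear.negP-homo (✱-isLinearˡ B) (φ (yP ·P a))))))
               (φ-y·negP (φ (yP ·P a) ✱ B))
  T₃-image : φ T₃ ≋ negP ((yP ·P zP) ·P (a ◇ b))
  T₃-image = begin
    φ T₃                         ≈⟨ φ-·P (yP ·P xP) (A ✱ B) ⟩
    φ (yP ·P xP) ·P (a ◇ b)      ≈⟨ ·P-congʳ (a ◇ b) (≋-trans (φ-y· xP) (negP-cong (·P-congˡ yP φ-x))) ⟩
    negP (yP ·P zP) ·P (a ◇ b)   ≈⟨ -‿distribˡ-* (yP ·P zP) (a ◇ b) ⟨
    negP ((yP ·P zP) ·P (a ◇ b)) ∎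

-- By definition f_{n+1}(w) = Δ (λ k → y^k ◇ w) n.
Δ : (ℕ → Poly) → ℕ → Poly
Δ s k = s (suc k) -P s k ·P yP

Δ-cong : ∀ {s t} → (∀ k → s k ≋ t k) → ∀ n → Δ s n ≋ Δ t n
Δ-cong s≋t n = -P-cong (s≋t (suc n)) (·P-congʳ yP (s≋t n))

Δ-+P : ∀ s t n → Δ (λ k → s k +P t k) n ≋ Δ s n +P Δ t n
Δ-+P s t n = ≋-trans (-P-cong (≋-refl {s (suc n) +P t (suc n)}) (IsLinear.+P-homo (·P-isLinearˡ yP) (s n) (t n)))
                     (-P-+P-interchange (s (suc n)) (t (suc n)) (s n ·P yP) (t n ·P yP))

Δ-·P : ∀ c s n → Δ (λ k → c ·P s k) n ≋ c ·P Δ s n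
Δ-·P c s n = ≋-trans (-P-cong (≋-refl {c ·P s (suc n)}) (·P-assoc c (s n) yP))
                     (≋-sym (IsLinear.-P-homo (·P-isLinearʳ c) (s (suc n)) (s n ·P yP)))

f-isLinear : ∀ n → IsLinear (f (+ n))
f-isLinear zero    = record { cong-≋ = λ e → e ; +P-homo = λ _ _ → ≋-refl ; ⋆-homo = λ _ _ → ≋-refl }
f-isLinear (suc n) = -P-isLinear (◇-isLinearʳ (powP yP (suc n))) (∘-isLinear (·P-isLinearˡ yP) (◇-isLinearʳ (powP yP n)))

f-z : ∀ n b → f (+ n) (zP ·P b) ≋ zP ·P f (+ n) b
f-z zero    b = ≋-refl
f-z (suc n) b = ≋-trans (Δ-cong (λ k → ◇-zʳ (powP yP k) b) n) (Δ-·P zP (λ k → powP yP k ◇ b) n)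

f-1 : ∀ n → f (+ suc n) 1P ≋ 0P
f-1 n = ≋-trans (Δ-cong (λ k → ◇-identityʳ (powP yP k)) n)
                (≋-trans (-P-cong (powP-comm yP n) ≋-refl) (-P-inverseʳ (powP yP n ·P yP)))

-- The k-th term is y^(k-1) ◇ w; taking the term for k = 0 to be 0 makes f_n(w) = Δ (pow◇ w) n hold also for n = 0.
pow◇ : Poly → ℕ → Poly
pow◇ w zero    = 0P
pow◇ w (suc k) = powP yP k ◇ w

f≋Δpow◇ : ∀ n w → f (+ n) w ≋ Δ (pow◇ w) n
f≋Δpow◇ zero    w = ≋-sym (≋-trans (+P-identityʳ (1P ◇ w)) (◇-identityˡ w))
f≋Δpow◇ (suc n) w = ≋-refl

pow◇-y : ∀ b k → pow◇ (yP ·P b) (suc k)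
                   ≋ yP ·P pow◇ (yP ·P b) k +P yP ·P pow◇ b (suc k) +P negP (yP ·P zP) ·P pow◇ b k
pow◇-y b zero    = ≋-trans (◇-identityˡ (yP ·P b))
                     (≋-trans (·P-congˡ yP (≋-sym (◇-identityˡ b))) (≋-sym (+P-identityʳ (yP ·P (1P ◇ b)))))
pow◇-y b (suc k) = ≋-trans (◇-y (powP yP k) b) (+P-congˡ _ (-‿distribˡ-* (yP ·P zP) (powP yP k ◇ b)))

f-y : ∀ n b → f (+ suc n) (yP ·P b) ≋ yP ·P f (+ n) (yP ·P b) +P yP ·P f (+ suc n) b -P (yP ·P zP) ·P f (+ n) b
f-y n b = begin
  Δ (pow◇ (yP ·P b)) (suc n)
    ≈⟨ Δ-cong (pow◇-y b) n ⟩
  Δ (λ k → yP ·P s₁ k +P yP ·P s₂ (suc k) +P c ·P s₂ k) n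
    ≈⟨ Δ-+P (λ k → yP ·P s₁ k +P yP ·P s₂ (suc k)) (λ k → c ·P s₂ k) n ⟩
  Δ (λ k → yP ·P s₁ k +P yP ·P s₂ (suc k)) n +P Δ (λ k → c ·P s₂ k) n
    ≈⟨ +P-cong (Δ-+P (λ k → yP ·P s₁ k) (λ k → yP ·P s₂ (suc k)) n) (Δ-·P c s₂ n) ⟩
  Δ (λ k → yP ·P s₁ k) n +P Δ (λ k → yP ·P s₂ (suc k)) n +P c ·P Δ s₂ n
    ≈⟨ +P-cong (+P-cong (Δ-·P yP s₁ n) (Δ-·P yP (s₂ ∘ suc) n)) (·P-congˡ c (≋-sym (f≋Δpow◇ n b))) ⟩
  yP ·P Δ s₁ n +P yP ·P Δ s₂ (suc n) +P c ·P f (+ n) b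
    ≈⟨ +P-cong (+P-cong (·P-congˡ yP (≋-sym (f≋Δpow◇ n (yP ·P b)))) (·P-congˡ yP (≋-sym (f≋Δpow◇ (suc n) b))))
               (≋-sym (-‿distribˡ-* (yP ·P zP) (f (+ n) b))) ⟩
  yP ·P f (+ n) (yP ·P b) +P yP ·P f (+ suc n) b -P (yP ·P zP) ·P f (+ n) b ∎
  where
  open ≋-Reasoning
  s₁ = pow◇ (yP ·P b)
  s₂ = pow◇ b
  c = negP (yP ·P zP)

-- (S ·S T) m unfolds to conv (λ i k → S i ·P T k) m, and the right-hand side of the theorem to
-- conv (λ i k → f (+ i) ((σ k) w)) m.
conv : (ℕ → ℕ → Poly) → ℕ → Poly
conv h m = Σ[j≤ m ] (λ j → h j (m ∸ j))

conv-zero : ∀ h → conv h 0 ≋ h 0 0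
conv-zero h = +P-identityʳ (h 0 0)

conv-suc : ∀ h m → conv h (suc m) ≡ h 0 (suc m) +P conv (h ∘ suc) m
conv-suc h m = cong (λ l → h 0 (suc m) +P sumP l)
  (trans (List.map-applyUpTo suc g (suc m)) (sym (List.map-applyUpTo (λ j → j) (g ∘ suc) (suc m))))
  where
  g : ℕ → Poly
  g j = h j (suc m ∸ j)

sumP-map-cong : ∀ {A B : ℕ → Poly} → (∀ j → A j ≋ B j) → ∀ l → sumP (map A l) ≋ sumP (map B l)
sumP-map-cong A≋B []      = ≋-refl
sumP-map-cong A≋B (j ∷ l) = +P-cong (A≋B j) (sumP-map-cong A≋B l)

sumP-map-+P : ∀ (A B : ℕ → Poly) l → sumP (map (λ j → A j +P B j) l) ≋ sumP (map A l) +P sumP (map B l)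
sumP-map-+P A B []      = ≋-refl
sumP-map-+P A B (j ∷ l) = ≋-trans (+P-congˡ (A j +P B j) (sumP-map-+P A B l))
                                  (interchange (A j) (B j) (sumP (map A l)) (sumP (map B l)))

conv-cong : ∀ {h h′} → (∀ i k → h i k ≋ h′ i k) → ∀ m → conv h m ≋ conv h′ m
conv-cong h≋h′ m = sumP-map-cong (λ j → h≋h′ j (m ∸ j)) (upTo (suc m))

conv-+P : ∀ h h′ m → conv (λ i k → h i k +P h′ i k) m ≋ conv h m +P conv h′ m
conv-+P h h′ m = sumP-map-+P (λ j → h j (m ∸ j)) (λ j → h′ j (m ∸ j)) (upTo (suc m))

conv-homo : ∀ {L} → IsLinear L → ∀ h m → L (conv h m) ≋ conv (λ i k → L (h i k)) m
conv-homo L-lin h m = ≋-trans (IsLinear.sumP-homo L-lin (map (λ j → h j (m ∸ j)) (upTo (suc m))))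
                              (≋-reflexive (cong sumP (sym (List.map-∘ (upTo (suc m))))))

conv-−P : ∀ h h′ m → conv (λ i k → h i k -P h′ i k) m ≋ conv h m -P conv h′ m
conv-−P h h′ m = ≋-trans (conv-+P h (λ i k → negP (h′ i k)) m)
                         (+P-congˡ (conv h m) (≋-sym (conv-homo negP-isLinear h′ m)))

sumP-map-lin : ∀ (G : ℕ → Word → Poly) w l → sumP (map (λ j → lin (G j) w) l) ≋ lin (λ u → sumP (map (λ j → G j u) l)) w
sumP-map-lin G w []      = ≋-reflexive (sym (lin-0ˡ w))
sumP-map-lin G w (j ∷ l) = ≋-trans (+P-congˡ (lin (G j) w) (sumP-map-lin G w l))
                                   (≋-sym (lin-+ˡ (G j) (λ u → sumP (map (λ j → G j u) l)) w))

conv-lin : ∀ (G : ℕ → ℕ → Word → Poly) w m → conv (λ i k → lin (G i k) w) m ≋ lin (λ u → conv (λ i k → G i k u) m) w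
conv-lin G w m = sumP-map-lin (λ j → G j (m ∸ j)) w (upTo (suc m))

conv-vanishing : ∀ {h} → (∀ i k → h i k ≋ 0P) → ∀ m → conv h m ≋ 0P
conv-vanishing h≋0 m = ≋-trans (conv-cong h≋0 m) (≋-reflexive (sumP-zeros (upTo (suc m))))
  where
  sumP-zeros : ∀ l → sumP (map (λ _ → 0P) l) ≡ 0P
  sumP-zeros []      = refl
  sumP-zeros (_ ∷ l) = sumP-zeros l

conv-shift : ∀ h → (∀ i → h i 0 ≋ 0P) → ∀ m → conv h (suc m) ≋ conv (λ i k → h i (suc k)) m
conv-shift h h≋0 zero    = ≋-trans (≋-reflexive (conv-suc h 0))
                             (≋-trans (+P-congˡ (h 0 1) (≋-trans (conv-zero (h ∘ suc)) (h≋0 1)))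
                               (≋-trans (+P-identityʳ (h 0 1)) (≋-sym (conv-zero (λ i k → h i (suc k))))))
conv-shift h h≋0 (suc m) = ≋-trans (≋-reflexive (conv-suc h (suc m)))
                             (≋-trans (+P-congˡ (h 0 (suc (suc m))) (conv-shift (h ∘ suc) (h≋0 ∘ suc) m))
                               (≋-reflexive (sym (conv-suc (λ i k → h i (suc k)) m))))

-- Multiplication by T.
shiftS : Series → Series
shiftS S zero    = 0P
shiftS S (suc k) = S k

constS-·S : ∀ p S m → (constS p ·S S) m ≋ p ·P S m
constS-·S p S zero    = conv-zero (λ i k → constS p i ·P S k)
constS-·S p S (suc m) = ≋-trans (≋-reflexive (conv-suc (λ i k → constS p i ·P S k) m))
                          (≋-trans (+P-congˡ (p ·P S (suc m)) (conv-vanishing (λ _ _ → ≋-refl) m))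
                            (+P-identityʳ (p ·P S (suc m))))

·S-oneS : ∀ S m → (S ·S oneS) m ≋ S m
·S-oneS S zero    = ≋-trans (conv-zero (λ i k → S i ·P oneS k)) (·P-identityʳ (S 0))
·S-oneS S (suc m) = ≋-trans (≋-reflexive (conv-suc (λ i k → S i ·P oneS k) m))
                      (+P-cong (IsLinear.0P-homo (·P-isLinearʳ (S 0))) (·S-oneS (S ∘ suc) m))

·S-shiftS : ∀ A C m → (A ·S shiftS C) m ≋ shiftS (A ·S C) m
·S-shiftS A C zero    = ≋-trans (conv-zero (λ i k → A i ·P shiftS C k)) (IsLinear.0P-homo (·P-isLinearʳ (A 0)))
·S-shiftS A C (suc m) = conv-shift (λ i k → A i ·P shiftS C k) (λ i → IsLinear.0P-homo (·P-isLinearʳ (A i))) m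

σWord-∷ʳX : ∀ v m → σWord (v ++ X ∷ []) m ≋ σWord v m ·P xP
σWord-∷ʳX []      m       = ≋-trans (constS-·S xP oneS m) (oneS-central m)
  where
  oneS-central : ∀ m → xP ·P oneS m ≋ oneS m ·P xP
  oneS-central zero    = ≋-trans (·P-identityʳ xP) (≋-sym (·P-identityˡ xP))
  oneS-central (suc m) = ≋-refl
σWord-∷ʳX (a ∷ v) m = ≋-trans (conv-cong (λ i k → ≋-trans (·P-congˡ (σLetter a i) (σWord-∷ʳX v k))
                                                           (≋-sym (·P-assoc (σLetter a i) (σWord v k) xP))) m)
                              (≋-sym (conv-homo (·P-isLinearˡ xP) (λ i k → σLetter a i ·P σWord v k) m))

σWord-∷ʳY : ∀ v m → σWord (v ++ Y ∷ []) m ≋ σWord v m ·P yP +P shiftS (σWord (v ++ Y ∷ [])) m ·P xP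
σWord-∷ʳY [] zero    = ≋-trans (·S-oneS (σLetter Y) 0)
                         (≋-trans (·P-identityʳ yP) (≋-sym (≋-trans (+P-identityʳ (1P ·P yP)) (·P-identityˡ yP))))
σWord-∷ʳY [] (suc m) = ≋-trans (·S-oneS (σLetter Y) (suc m)) (begin
  yP ·P (xP ·P powP xP m)    ≈⟨ ·P-congˡ yP (powP-comm xP m) ⟩
  yP ·P (powP xP m ·P xP)    ≈⟨ ·P-assoc yP (powP xP m) xP ⟨
  (yP ·P powP xP m) ·P xP    ≈⟨ ·P-congʳ xP (·S-oneS (σLetter Y) m) ⟨
  σWord (Y ∷ []) m ·P xP     ∎)
  where open ≋-Reasoning
σWord-∷ʳY (a ∷ v) m = begin
  conv (λ i k → σa i ·P C k) m
    ≈⟨ conv-cong (λ i k → ≋-trans (·P-congˡ (σa i) (σWord-∷ʳY v k))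
                            (IsLinear.+P-homo (·P-isLinearʳ (σa i)) (σv k ·P yP) (shiftS C k ·P xP))) m ⟩
  conv (λ i k → σa i ·P (σv k ·P yP) +P σa i ·P (shiftS C k ·P xP)) m
    ≈⟨ conv-+P (λ i k → σa i ·P (σv k ·P yP)) (λ i k → σa i ·P (shiftS C k ·P xP)) m ⟩
  conv (λ i k → σa i ·P (σv k ·P yP)) m +P conv (λ i k → σa i ·P (shiftS C k ·P xP)) m
    ≈⟨ +P-cong (moveRight yP σv) (moveRight xP (shiftS C)) ⟩
  (σa ·S σv) m ·P yP +P (σa ·S shiftS C) m ·P xP
    ≈⟨ +P-congˡ ((σa ·S σv) m ·P yP) (·P-congʳ xP (·S-shiftS σa C m)) ⟩
  (σa ·S σv) m ·P yP +P shiftS (σa ·S C) m ·P xP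
    ∎
  where
  open ≋-Reasoning
  σa = σLetter a
  σv = σWord v
  C  = σWord (v ++ Y ∷ [])
  moveRight : ∀ r S → conv (λ i k → σa i ·P (S k ·P r)) m ≋ (σa ·S S) m ·P r
  moveRight r S = ≋-trans (conv-cong (λ i k → ≋-sym (·P-assoc (σa i) (S k) r)) m)
                          (≋-sym (conv-homo (·P-isLinearˡ r) (λ i k → σa i ·P S k) m))

τW : Word → Word
τW u = reverse (map swapL u)

τW-∷ : ∀ a u → τW (a ∷ u) ≡ τW u ++ swapL a ∷ []
τW-∷ a u = List.unfold-reverse (swapL a) (map swapL u)

τ-isLinear : IsLinear τ
τ-isLinear = lin-isLinear (wordP ∘ τW)

τ-·P : ∀ p q → τ (p ·P q) ≋ τ q ·P τ p
τ-·P = lin-·P-antihomo (wordP ∘ τW) λ u v →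
  ≋-sym (≋-trans (wordP-·P (τW v) (τW u)) (≋-reflexive (cong wordP (τW-++ u v))))
  where
  τW-++ : ∀ u v → τW v ++ τW u ≡ τW (u ++ v)
  τW-++ u v = trans (sym (List.reverse-++ (map swapL u) (map swapL v))) (cong reverse (sym (List.map-++ swapL u v)))

σ̄Word : ℕ → Word → Poly
σ̄Word m u = τ (σWord (τW u) m)

σ̄Word-[] : ∀ m → σ̄Word m [] ≋ oneS m
σ̄Word-[] zero    = lin-word (wordP ∘ τW) []
σ̄Word-[] (suc m) = ≋-refl

σ̄Word-y : ∀ m u → σ̄Word m (Y ∷ u) ≋ yP ·P σ̄Word m u
σ̄Word-y m u = begin
  τ (σWord (τW (Y ∷ u)) m)          ≡⟨ cong (λ v → τ (σWord v m)) (τW-∷ Y u) ⟩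
  τ (σWord (τW u ++ X ∷ []) m)      ≈⟨ IsLinear.cong-≋ τ-isLinear (σWord-∷ʳX (τW u) m) ⟩
  τ (σWord (τW u) m ·P xP)          ≈⟨ τ-·P (σWord (τW u) m) xP ⟩
  τ xP ·P σ̄Word m u                 ≈⟨ ·P-congʳ (σ̄Word m u) (lin-word (wordP ∘ τW) (X ∷ [])) ⟩
  yP ·P σ̄Word m u                   ∎
  where open ≋-Reasoning

σ̄Word-x : ∀ m u → σ̄Word m (X ∷ u) ≋ xP ·P σ̄Word m u +P yP ·P shiftS (λ k → σ̄Word k (X ∷ u)) m
σ̄Word-x m u = begin
  τ (σWord (τW (X ∷ u)) m)          ≡⟨ cong (λ v → τ (σWord v m)) (τW-∷ X u) ⟩
  τ (σWord (τW u ++ Y ∷ []) m)      ≈⟨ IsLinear.cong-≋ τ-isLinear (σWord-∷ʳY (τW u) m) ⟩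
  τ (σWord (τW u) m ·P yP +P C m ·P xP)
    ≈⟨ IsLinear.+P-homo τ-isLinear (σWord (τW u) m ·P yP) (C m ·P xP) ⟩
  τ (σWord (τW u) m ·P yP) +P τ (C m ·P xP)
    ≈⟨ +P-cong (≋-trans (τ-·P (σWord (τW u) m) yP) (·P-congʳ (σ̄Word m u) (lin-word (wordP ∘ τW) (Y ∷ []))))
               (≋-trans (τ-·P (C m) xP) (·P-cong (lin-word (wordP ∘ τW) (X ∷ [])) (τ-shiftS m))) ⟩
  xP ·P σ̄Word m u +P yP ·P shiftS (λ k → σ̄Word k (X ∷ u)) m ∎
  where
  open ≋-Reasoning
  C = shiftS (σWord (τW u ++ Y ∷ []))
  τ-shiftS : ∀ m → τ (C m) ≋ shiftS (λ k → σ̄Word k (X ∷ u)) m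
  τ-shiftS zero    = ≋-refl
  τ-shiftS (suc k) = ≋-reflexive (cong (λ v → τ (σWord v k)) (sym (τW-∷ X u)))

fΣ : Series → Series
fΣ S m = conv (λ i k → f (+ i) (S k)) m

fΣ-cong : ∀ {S S′} → (∀ k → S k ≋ S′ k) → ∀ m → fΣ S m ≋ fΣ S′ m
fΣ-cong S≋S′ = conv-cong (λ i k → IsLinear.cong-≋ (f-isLinear i) (S≋S′ k))

fΣ-zero : ∀ S → fΣ S 0 ≋ S 0
fΣ-zero S = conv-zero (λ i k → f (+ i) (S k))

fΣ-+P : ∀ S S′ m → fΣ (λ k → S k +P S′ k) m ≋ fΣ S m +P fΣ S′ m
fΣ-+P S S′ m = ≋-trans (conv-cong (λ i k → IsLinear.+P-homo (f-isLinear i) (S k) (S′ k)) m)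
                       (conv-+P (λ i k → f (+ i) (S k)) (λ i k → f (+ i) (S′ k)) m)

fΣ-−P : ∀ S S′ m → fΣ (λ k → S k -P S′ k) m ≋ fΣ S m -P fΣ S′ m
fΣ-−P S S′ m = ≋-trans (conv-cong (λ i k → IsLinear.-P-homo (f-isLinear i) (S k) (S′ k)) m)
                       (conv-−P (λ i k → f (+ i) (S k)) (λ i k → f (+ i) (S′ k)) m)

fΣ-z : ∀ S m → fΣ (λ k → zP ·P S k) m ≋ zP ·P fΣ S m
fΣ-z S m = ≋-trans (conv-cong (λ i k → f-z i (S k)) m)
                   (≋-sym (conv-homo (·P-isLinearʳ zP) (λ i k → f (+ i) (S k)) m))

fΣ-shiftS : ∀ S m → fΣ (shiftS S) (suc m) ≋ fΣ S m
fΣ-shiftS S = conv-shift (λ i k → f (+ i) (shiftS S k)) (λ i → IsLinear.0P-homo (f-isLinear i))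

fΣ-y : ∀ S m → fΣ (λ k → yP ·P S k) (suc m)
                 ≋ yP ·P fΣ (λ k → yP ·P S k) m +P yP ·P fΣ S (suc m) -P (yP ·P zP) ·P fΣ S m
fΣ-y S m = begin
  fΣ yS (suc m)                                                   ≡⟨ conv-suc (λ i k → f (+ i) (yS k)) m ⟩
  yP ·P S (suc m) +P conv (λ i k → f (+ suc i) (yP ·P S k)) m
    ≈⟨ +P-congˡ (yP ·P S (suc m)) (≋-trans (conv-cong (λ i k → f-y i (S k)) m)
         (≋-trans (conv-−P (λ i k → yP ·P f (+ i) (yP ·P S k) +P yP ·P F′ i k) (λ i k → (yP ·P zP) ·P f (+ i) (S k)) m)
           (-P-cong (≋-trans (conv-+P (λ i k → yP ·P f (+ i) (yP ·P S k)) (λ i k → yP ·P F′ i k) m)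
                             (+P-cong (pull yP (λ i k → f (+ i) (yP ·P S k))) (pull yP F′)))
                    (pull (yP ·P zP) (λ i k → f (+ i) (S k)))))) ⟩
  yP ·P S (suc m) +P (yP ·P fΣ yS m +P yP ·P conv F′ m -P (yP ·P zP) ·P fΣ S m)
    ≈⟨ solve 4 (λ a g c h → a ⊕ ((g ⊕ c) ⊕ h) ⊜ (g ⊕ (a ⊕ c)) ⊕ h) ≋-refl
         (yP ·P S (suc m)) (yP ·P fΣ yS m) (yP ·P conv F′ m) (negP ((yP ·P zP) ·P fΣ S m)) ⟩
  yP ·P fΣ yS m +P (yP ·P S (suc m) +P yP ·P conv F′ m) -P (yP ·P zP) ·P fΣ S m
    ≈⟨ +P-congʳ (negP ((yP ·P zP) ·P fΣ S m)) (+P-congˡ (yP ·P fΣ yS m)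
         (≋-sym (≋-trans (·P-congˡ yP (≋-reflexive (conv-suc (λ i k → f (+ i) (S k)) m)))
                         (IsLinear.+P-homo (·P-isLinearʳ yP) (S (suc m)) (conv F′ m))))) ⟩
  yP ·P fΣ yS m +P yP ·P fΣ S (suc m) -P (yP ·P zP) ·P fΣ S m ∎
  where
  open ≋-Reasoning
  yS : Series
  yS k = yP ·P S k
  F′ : ℕ → ℕ → Poly
  F′ i k = f (+ suc i) (S k)
  pull : ∀ c h → conv (λ i k → c ·P h i k) m ≋ c ·P conv h m
  pull c h = ≋-sym (conv-homo (·P-isLinearʳ c) h m)

fΣ-oneS : ∀ m → fΣ oneS m ≋ oneS m
fΣ-oneS zero    = fΣ-zero oneS
fΣ-oneS (suc m) = ≋-trans (≋-reflexive (conv-suc (λ i k → f (+ i) (oneS k)) m)) (conv-vanishing f-oneS m)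
  where
  f-oneS : ∀ i k → f (+ suc i) (oneS k) ≋ 0P
  f-oneS i zero    = f-1 i
  f-oneS i (suc k) = IsLinear.0P-homo (f-isLinear (suc i))

x≋z-y : ∀ p → xP ·P p ≋ zP ·P p -P yP ·P p
x≋z-y p = ≋-sym (≋-trans (+P-congʳ (negP (yP ·P p)) (IsLinear.+P-homo (·P-isLinearˡ p) xP yP))
                         (+P-cancelʳ (xP ·P p) (yP ·P p)))

HasExpansion : Word → Set
HasExpansion u = ∀ m → σ̄Word m u ≋ fΣ (σWord u) m

-- fΣ σ(xu) = z · fΣ σ(u) − fΣ (y σ(u)) satisfies the recursion σ̄Word-x of σ̄(xu).
σ̄Word-expansion-x : ∀ u → HasExpansion u → HasExpansion (X ∷ u)
σ̄Word-expansion-x u IH m = ≋-trans (σ̄Word≋R m) (≋-sym fΣσx≋R)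
  where
  S = σWord u
  H = fΣ S
  G = fΣ (λ k → yP ·P S k)
  R : ℕ → Poly
  R m = zP ·P H m -P G m
  fΣσx≋R : fΣ (σWord (X ∷ u)) m ≋ R m
  fΣσx≋R = ≋-trans (fΣ-cong (λ k → ≋-trans (constS-·S xP S k) (x≋z-y (S k))) m)
                   (≋-trans (fΣ-−P (λ k → zP ·P S k) (λ k → yP ·P S k) m) (-P-cong (fΣ-z S m) ≋-refl))
  R-suc : ∀ m → R (suc m) ≋ xP ·P H (suc m) +P yP ·P R m
  R-suc m = begin
    zP ·P H′ -P G (suc m)                                         ≈⟨ -P-cong (≋-refl {zP ·P H′}) (fΣ-y S m) ⟩
    zP ·P H′ -P (yP ·P G m +P yP ·P H′ -P (yP ·P zP) ·P H m)      ≈⟨ +P-congʳ _ (IsLinear.+P-homo (·P-isLinearˡ H′) xP yP) ⟩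
    (xP ·P H′ +P yP ·P H′) -P (yP ·P G m +P yP ·P H′ -P (yP ·P zP) ·P H m)
      ≈⟨ regroup (xP ·P H′) ((yP ·P zP) ·P H m) (yP ·P G m) (yP ·P H′) ⟨
    xP ·P H′ +P ((yP ·P zP) ·P H m -P yP ·P G m)
      ≈⟨ +P-congˡ (xP ·P H′) (-P-cong (·P-assoc yP zP (H m)) ≋-refl) ⟩
    xP ·P H′ +P (yP ·P (zP ·P H m) -P yP ·P G m)
      ≈⟨ +P-congˡ (xP ·P H′) (IsLinear.-P-homo (·P-isLinearʳ yP) (zP ·P H m) (G m)) ⟨
    xP ·P H′ +P yP ·P R m                                         ∎
    where
    open ≋-Reasoning
    H′ = H (suc m)
    regroup : ∀ a b c d → a +P (b -P c) ≋ (a +P d) -P (c +P d -P b)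
    regroup a b c d = ≋-sym (begin
      (a +P d) +P negP ((c +P d) -P b)       ≈⟨ +P-congˡ (a +P d) (⁻¹-anti-homo‿- (c +P d) b) ⟩
      (a +P d) +P (b +P negP (c +P d))       ≈⟨ +P-congˡ (a +P d) (+P-congˡ b (⁻¹-∙-comm c d)) ⟨
      (a +P d) +P (b +P (negP c +P negP d))
        ≈⟨ solve 5 (λ a b d c′ d′ → (a ⊕ d) ⊕ (b ⊕ (c′ ⊕ d′)) ⊜ (a ⊕ (b ⊕ c′)) ⊕ (d ⊕ d′)) ≋-refl a b d (negP c) (negP d) ⟩
      (a +P (b -P c)) +P (d -P d)            ≈⟨ +P-congˡ (a +P (b -P c)) (-P-inverseʳ d) ⟩
      (a +P (b -P c)) +P 0P                  ≈⟨ +P-identityʳ (a +P (b -P c)) ⟩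
      a +P (b -P c)                          ∎)
  σ̄Word≋R : ∀ m → σ̄Word m (X ∷ u) ≋ R m
  σ̄Word≋R zero    = begin
    σ̄Word 0 (X ∷ u)          ≈⟨ ≋-trans (σ̄Word-x 0 u) (+P-identityʳ (xP ·P σ̄Word 0 u)) ⟩
    xP ·P σ̄Word 0 u          ≈⟨ ·P-congˡ xP (≋-trans (IH 0) (fΣ-zero S)) ⟩
    xP ·P S 0                ≈⟨ x≋z-y (S 0) ⟩
    zP ·P S 0 -P yP ·P S 0   ≈⟨ -P-cong (·P-congˡ zP (fΣ-zero S)) (fΣ-zero (λ k → yP ·P S k)) ⟨
    R 0                      ∎
    where open ≋-Reasoning
  σ̄Word≋R (suc m) = begin
    σ̄Word (suc m) (X ∷ u)                             ≈⟨ σ̄Word-x (suc m) u ⟩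
    xP ·P σ̄Word (suc m) u +P yP ·P σ̄Word m (X ∷ u)    ≈⟨ +P-cong (·P-congˡ xP (IH (suc m))) (·P-congˡ yP (σ̄Word≋R m)) ⟩
    xP ·P H (suc m) +P yP ·P R m                      ≈⟨ R-suc m ⟨
    R (suc m)                                         ∎
    where open ≋-Reasoning

σ̄Word-expansion-y : ∀ u → HasExpansion u → HasExpansion (Y ∷ u)
σ̄Word-expansion-y u IH m = begin
  σ̄Word m (Y ∷ u)               ≈⟨ σ̄Word-y m u ⟩
  yP ·P σ̄Word m u               ≈⟨ ·P-congˡ yP (IH m) ⟩
  yP ·P H m                     ≈⟨ G≋yH m ⟨
  fΣ (λ k → yP ·P A k) m        ≈⟨ fΣ-cong σyu≋yA m ⟨
  fΣ (σWord (Y ∷ u)) m          ∎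
  where
  open ≋-Reasoning
  S = σWord u
  H = fΣ S
  -- A = (Σ xⁿTⁿ) σ(u), so that σ(yu) = y A.
  A : Series
  A m = conv (λ i k → powP xP i ·P S k) m
  B = fΣ A
  G = fΣ (λ k → yP ·P A k)
  σyu≋yA : ∀ k → σWord (Y ∷ u) k ≋ yP ·P A k
  σyu≋yA k = ≋-trans (conv-cong (λ i j → ·P-assoc yP (powP xP i) (S j)) k)
                     (≋-sym (conv-homo (·P-isLinearʳ yP) (λ i j → powP xP i ·P S j) k))
  A-rec : ∀ k → A k ≋ S k +P xP ·P shiftS A k
  A-rec zero    = ≋-trans (conv-zero (λ i j → powP xP i ·P S j))
                          (≋-trans (·P-identityˡ (S 0)) (≋-sym (+P-identityʳ (S 0))))
  A-rec (suc k) = ≋-trans (≋-reflexive (conv-suc (λ i j → powP xP i ·P S j) k))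
                    (+P-cong (·P-identityˡ (S (suc k)))
                      (≋-trans (conv-cong (λ i j → ·P-assoc xP (powP xP i) (S j)) k)
                               (≋-sym (conv-homo (·P-isLinearʳ xP) (λ i j → powP xP i ·P S j) k))))
  B-rec : ∀ m → B (suc m) ≋ H (suc m) +P (zP ·P B m -P G m)
  B-rec m = begin
    B (suc m)                                         ≈⟨ fΣ-cong A-rec (suc m) ⟩
    fΣ (λ k → S k +P xP ·P shiftS A k) (suc m)        ≈⟨ fΣ-+P S (λ k → xP ·P shiftS A k) (suc m) ⟩
    H (suc m) +P fΣ (λ k → xP ·P shiftS A k) (suc m)  ≈⟨ +P-congˡ (H (suc m)) (fΣ-cong (λ k → x≋z-y (shiftS A k)) (suc m)) ⟩
    H (suc m) +P fΣ (λ k → zP ·P shiftS A k -P yP ·P shiftS A k) (suc m)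
      ≈⟨ +P-congˡ (H (suc m)) (≋-trans (fΣ-−P (λ k → zP ·P shiftS A k) (λ k → yP ·P shiftS A k) (suc m))
           (-P-cong (≋-trans (fΣ-z (shiftS A) (suc m)) (·P-congˡ zP (fΣ-shiftS A m)))
                    (≋-trans (fΣ-cong y-shiftS (suc m)) (fΣ-shiftS (λ k → yP ·P A k) m)))) ⟩
    H (suc m) +P (zP ·P B m -P G m)                   ∎
    where
    y-shiftS : ∀ k → yP ·P shiftS A k ≋ shiftS (λ k → yP ·P A k) k
    y-shiftS zero    = ≋-refl
    y-shiftS (suc k) = ≋-refl
  G≋yH : ∀ m → G m ≋ yP ·P H m
  G≋yH zero    = ≋-trans (fΣ-zero (λ k → yP ·P A k))
                   (·P-congˡ yP (≋-trans (A-rec 0) (≋-trans (+P-identityʳ (S 0)) (≋-sym (fΣ-zero S)))))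
  G≋yH (suc m) = begin
    G (suc m)                                                        ≈⟨ fΣ-y A m ⟩
    yP ·P G m +P yP ·P B (suc m) -P (yP ·P zP) ·P B m               ≈⟨ +P-congʳ _ (+P-congˡ (yP ·P G m) (·P-congˡ yP (B-rec m))) ⟩
    yP ·P G m +P yP ·P (H′ +P (zP ·P B m -P G m)) -P (yP ·P zP) ·P B m
      ≈⟨ +P-congʳ _ (+P-congˡ (yP ·P G m) y-distrib) ⟩
    yP ·P G m +P (yP ·P H′ +P ((yP ·P zP) ·P B m -P yP ·P G m)) -P (yP ·P zP) ·P B m
      ≈⟨ cancel (yP ·P G m) (yP ·P H′) ((yP ·P zP) ·P B m) ⟩
    yP ·P H′                                                         ∎
    where
    H′ = H (suc m)
    y-distrib : yP ·P (H′ +P (zP ·P B m -P G m)) ≋ yP ·P H′ +P ((yP ·P zP) ·P B m -P yP ·P G m)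
    y-distrib = ≋-trans (IsLinear.+P-homo (·P-isLinearʳ yP) H′ (zP ·P B m -P G m))
                  (+P-congˡ (yP ·P H′) (≋-trans (IsLinear.-P-homo (·P-isLinearʳ yP) (zP ·P B m) (G m))
                                                (-P-cong (≋-sym (·P-assoc yP zP (B m))) ≋-refl)))
    cancel : ∀ g h b → g +P (h +P (b -P g)) -P b ≋ h
    cancel g h b = begin
      g +P (h +P (b -P g)) -P b
        ≈⟨ solve 5 (λ g h b g′ b′ → (g ⊕ (h ⊕ (b ⊕ g′))) ⊕ b′ ⊜ h ⊕ ((g ⊕ g′) ⊕ (b ⊕ b′))) ≋-refl g h b (negP g) (negP b) ⟩
      h +P ((g -P g) +P (b -P b))           ≈⟨ +P-congˡ h (+P-cong (-P-inverseʳ g) (-P-inverseʳ b)) ⟩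
      h +P 0P                               ≈⟨ +P-identityʳ h ⟩
      h                                     ∎

σ̄Word-expansion : ∀ u → HasExpansion u
σ̄Word-expansion []      m = ≋-trans (σ̄Word-[] m) (≋-sym (fΣ-oneS m))
σ̄Word-expansion (X ∷ u) m = σ̄Word-expansion-x u (σ̄Word-expansion u) m
σ̄Word-expansion (Y ∷ u) m = σ̄Word-expansion-y u (σ̄Word-expansion u) m

σ̄-lin : ∀ m w → (σ̄ m) w ≋ lin (σ̄Word m) w
σ̄-lin m w = begin
  τ (lin σₘ (lin (wordP ∘ τW) w))              ≈⟨ IsLinear.cong-≋ τ-isLinear (lin-lin σₘ (wordP ∘ τW) w) ⟩
  τ (lin (λ u → lin σₘ (wordP (τW u))) w)      ≈⟨ IsLinear.lin-homo τ-isLinear (λ u → lin σₘ (wordP (τW u))) w ⟩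
  lin (λ u → τ (lin σₘ (wordP (τW u)))) w      ≈⟨ lin-congˡ (λ u → IsLinear.cong-≋ τ-isLinear (lin-word σₘ (τW u))) w ⟩
  lin (σ̄Word m) w                              ∎
  where
  open ≋-Reasoning
  σₘ : Word → Poly
  σₘ u = σWord u m

fΣσ-lin : ∀ m w → fΣ (λ k → (σ k) w) m ≋ lin (λ u → fΣ (σWord u) m) w
fΣσ-lin m w = ≋-trans (conv-cong (λ i k → IsLinear.lin-homo (f-isLinear i) (λ u → σWord u k) w) m)
                      (conv-lin (λ i k u → f (+ i) (σWord u k)) w m)

lemma5p4 : (m : ℕ) (w : Poly) →
    (σ̄ m) w ≈ Σ[j≤ m ] (λ j → f (+ j) ((σ (m ∸ j)) w))
lemma5p4 m w = ≋⇒≈ (begin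
  (σ̄ m) w                        ≈⟨ σ̄-lin m w ⟩
  lin (σ̄Word m) w                ≈⟨ lin-congˡ (λ u → σ̄Word-expansion u m) w ⟩
  lin (λ u → fΣ (σWord u) m) w   ≈⟨ fΣσ-lin m w ⟨
  fΣ (λ k → (σ k) w) m           ∎)
  where open ≋-Reasoning
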